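{- Let $R$ be a ring and $\tau\in\mathbf{M}_{\mathrm{stab}}(R)$. Then $\mathbf{H}(R)\cap\mathbf{G}_\tau(R)=\{1\}$.
   Context: Rings are commutative with $1$. Let $\mathbf{V}$ be a free $\mathbb{Z}$-module of finite rank, $\mathbf{V}^*=\mathrm{Hom}(\mathbf{V},\mathbb{Z})$; fix $e\in\mathbf{V}$, $e^*\in\mathbf{V}^*$ with $e^*(e)=1$. For a ring $R$: $\mathbf{V}(R)=\mathbf{V}\otimes R$, $\mathbf{V}^*(R)=\mathrm{Hom}_R(\mathbf{V}(R),R)$, $\mathbf{M}(R)=\mathrm{End}_R(\mathbf{V}(R))$, $\mathbf{G}(R)=\mathrm{Aut}_R(\mathbf{V}(R))$. $\mathbf{V}_H(R)=\{v:e^*(v)=0\}$ and $\mathbf{H}(R)=\mathrm{Aut}_R(\mathbf{V}_H(R))$ viewed in $\mathbf{G}(R)$ by acting trivially on $Re$ (i.e. $\{g:ge=e,\ e^*\circ g=e^*\}$). $\mathbf{G}_\tau(R)$ is the centralizer of $\tau$ in $\mathbf{G}(R)$. $\tau\in\mathbf{M}(R)$ is stable if $R[\tau]e=\mathbf{V}(R)$ and $e^*\circ R[\tau]=\mathbf{V}^*(R)$; $\mathbf{M}_{\mathrm{stab}}(R)$ is the set of stable elements. -}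

module Defs where

open import Level using (_⊔_)
open import Data.Nat using (ℕ; zero; suc)
open import Data.Fin using (Fin; _≟_)
open import Relation.Nullary using (yes; no)
open import Data.List using (List; []; _∷_)
open import Data.Product using (Σ; ∃; _×_)
import Data.Integer as ℤ
open import Data.Integer using (ℤ)
open import Relation.Binary.PropositionalEquality using (_≡_)
open import Algebra.Bundles using (CommutativeRing)

sumℤ : ∀ {n} → (Fin n → ℤ) → ℤ
sumℤ {zero}  f = ℤ.+ 0
sumℤ {suc n} f = f Fin.zero ℤ.+ sumℤ (λ i → f (Fin.suc i))
  where import Data.Fin as Fin

-- Free Z-module V = ℤⁿ (rank n), V* = ℤⁿ via the standard dual basis.
-- Pairing  e*(e) = Σ e*_i e_i.
pairℤ : ∀ {n} → (Fin n → ℤ) → (Fin n → ℤ) → ℤ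
pairℤ f v = sumℤ (λ i → f i ℤ.* v i)

module Over {c ℓ} (R : CommutativeRing c ℓ) where
  open CommutativeRing R

  -- V(R) = Rⁿ, V*(R) = Hom_R(Rⁿ,R) ≅ Rⁿ (row vectors), M(R) = n×n matrices.
  Vec : ℕ → Set c
  Vec n = Fin n → Carrier

  Mat : ℕ → Set c
  Mat n = Fin n → Fin n → Carrier

  Σᴿ : ∀ {n} → (Fin n → Carrier) → Carrier
  Σᴿ {zero}  f = 0#
  Σᴿ {suc n} f = f Fin.zero + Σᴿ (λ i → f (Fin.suc i))
    where import Data.Fin as Fin

  natCast : ℕ → Carrier
  natCast zero    = 0#
  natCast (suc k) = 1# + natCast k

  intCast : ℤ → Carrier
  intCast (ℤ.+ k)      = natCast k
  intCast ℤ.-[1+ k ]   = - natCast (suc k)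

  baseV : ∀ {n} → (Fin n → ℤ) → Vec n
  baseV v i = intCast (v i)

  _≈ᵥ_ : ∀ {n} → Vec n → Vec n → Set ℓ
  u ≈ᵥ v = ∀ i → u i ≈ v i

  _≈ₘ_ : ∀ {n} → Mat n → Mat n → Set ℓ
  A ≈ₘ B = ∀ i j → A i j ≈ B i j

  _·ᵥ_ : ∀ {n} → Mat n → Vec n → Vec n
  (A ·ᵥ v) i = Σᴿ (λ j → A i j * v j)

  _∘ᶜ_ : ∀ {n} → Vec n → Mat n → Vec n
  (f ∘ᶜ A) j = Σᴿ (λ i → f i * A i j)

  _·ₘ_ : ∀ {n} → Mat n → Mat n → Mat n
  (A ·ₘ B) i k = Σᴿ (λ j → A i j * B j k)

  idM : ∀ {n} → Mat n
  idM i j with i ≟ j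
  ... | yes _ = 1#
  ... | no _  = 0#

  scal : ∀ {n} → Carrier → Vec n → Vec n
  scal a v i = a * v i

  addV : ∀ {n} → Vec n → Vec n → Vec n
  addV u v i = u i + v i

  zeroV : ∀ {n} → Vec n
  zeroV i = 0#

  -- p(τ) v  for p = Σ cₖ Xᵏ  given by its coefficient list [c₀, c₁, …]
  -- (Horner: p(τ)v = c₀ v + τ (p'(τ) v) where p = c₀ + X p')
  polyAct : ∀ {n} → Mat n → List Carrier → Vec n → Vec n
  polyAct τ []       v = zeroV
  polyAct τ (a ∷ cs) v = addV (scal a v) (τ ·ᵥ polyAct τ cs v)

  polyCoact : ∀ {n} → Mat n → List Carrier → Vec n → Vec n
  polyCoact τ []       f = zeroV
  polyCoact τ (a ∷ cs) f = addV (scal a f) (polyCoact τ cs f ∘ᶜ τ)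

  -- τ stable:  R[τ]e = V(R)  and  e* ∘ R[τ] = V*(R)
  IsStable : ∀ {n} → (e e* : Fin n → ℤ) → Mat n → Set (c ⊔ ℓ)
  IsStable e e* τ =
    (∀ (v : Vec _) → Σ (List Carrier) (λ p → polyAct τ p (baseV e) ≈ᵥ v)) ×
    (∀ (f : Vec _) → Σ (List Carrier) (λ p → polyCoact τ p (baseV e*) ≈ᵥ f))

  IsAut : ∀ {n} → Mat n → Set (c ⊔ ℓ)
  IsAut g = Σ (Mat _) (λ h → ((g ·ₘ h) ≈ₘ idM) × ((h ·ₘ g) ≈ₘ idM))

  InH : ∀ {n} → (e e* : Fin n → ℤ) → Mat n → Set (c ⊔ ℓ)
  InH e e* g = IsAut g × ((g ·ᵥ baseV e) ≈ᵥ baseV e) × ((baseV e* ∘ᶜ g) ≈ᵥ baseV e*)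

  InGτ : ∀ {n} → Mat n → Mat n → Set (c ⊔ ℓ)
  InGτ τ g = IsAut g × ((g ·ₘ τ) ≈ₘ (τ ·ₘ g))

{-# OPTIONS --safe #-}
-- g commutes with τ and fixes e, so it fixes p(τ)e for every polynomial p; stability says these
-- vectors exhaust V(R), so g fixes every vector, in particular every column of the identity.
module Submission where

open import Defs
open import Level using (Level)
open import Data.Nat using (ℕ; zero; suc)
open import Data.Fin using (Fin; zero; suc; _≟_)
open import Data.Integer using (ℤ)
open import Data.List using ([]; _∷_)
open import Data.Product using (_,_)
open import Function using (_∘_)
open import Relation.Nullary using (yes; no)
open import Relation.Binary.PropositionalEquality using (_≡_)
import Relation.Binary.PropositionalEquality as ≡
open import Algebra.Bundles using (CommutativeRing)

module Summation {c ℓ} (R : CommutativeRing c ℓ) where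
  open CommutativeRing R hiding (zero)
  open Over R using (Σᴿ; idM)
  open import Algebra.Properties.Semiring.Sum semiring
  open import Relation.Binary.Reasoning.Setoid setoid

  Σᴿ≡sum : ∀ {n} (f : Fin n → Carrier) → Σᴿ f ≡ sum f
  Σᴿ≡sum {zero}  f = ≡.refl
  Σᴿ≡sum {suc n} f = ≡.cong (f zero +_) (Σᴿ≡sum (f ∘ suc))

  Σᴿ≈sum : ∀ {n} (f : Fin n → Carrier) → Σᴿ f ≈ sum f
  Σᴿ≈sum f = reflexive (Σᴿ≡sum f)

  Σᴿ-cong : ∀ {n} {f h : Fin n → Carrier} → (∀ i → f i ≈ h i) → Σᴿ f ≈ Σᴿ h
  Σᴿ-cong {f = f} {h} f≈h = begin
    Σᴿ f   ≈⟨ Σᴿ≈sum f ⟩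
    sum f  ≈⟨ sum-cong-≋ f≈h ⟩
    sum h  ≈⟨ Σᴿ≈sum h ⟨
    Σᴿ h   ∎

  Σᴿ-zero : ∀ n → Σᴿ {n} (λ _ → 0#) ≈ 0#
  Σᴿ-zero n = trans (Σᴿ≈sum {n} (λ _ → 0#)) (sum-replicate-zero n)

  Σᴿ-distrib-+ : ∀ {n} (f h : Fin n → Carrier) → Σᴿ (λ i → f i + h i) ≈ Σᴿ f + Σᴿ h
  Σᴿ-distrib-+ f h = begin
    Σᴿ (λ i → f i + h i)  ≈⟨ Σᴿ≈sum (λ i → f i + h i) ⟩
    sum (λ i → f i + h i) ≈⟨ ∑-distrib-+ f h ⟩
    sum f + sum h         ≈⟨ +-cong (Σᴿ≈sum f) (Σᴿ≈sum h) ⟨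
    Σᴿ f + Σᴿ h           ∎

  *-distribˡ-Σᴿ : ∀ {n} x (f : Fin n → Carrier) → x * Σᴿ f ≈ Σᴿ (λ i → x * f i)
  *-distribˡ-Σᴿ x f = begin
    x * Σᴿ f             ≈⟨ *-congˡ (Σᴿ≈sum f) ⟩
    x * sum f            ≈⟨ *-distribˡ-sum x f ⟩
    sum (λ i → x * f i)  ≈⟨ Σᴿ≈sum (λ i → x * f i) ⟨
    Σᴿ (λ i → x * f i)   ∎

  *-distribʳ-Σᴿ : ∀ {n} x (f : Fin n → Carrier) → Σᴿ f * x ≈ Σᴿ (λ i → f i * x)
  *-distribʳ-Σᴿ x f = begin
    Σᴿ f * x             ≈⟨ *-congʳ (Σᴿ≈sum f) ⟩
    sum f * x            ≈⟨ *-distribʳ-sum x f ⟩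
    sum (λ i → f i * x)  ≈⟨ Σᴿ≈sum (λ i → f i * x) ⟨
    Σᴿ (λ i → f i * x)   ∎

  Σᴿ-comm : ∀ {m n} (f : Fin m → Fin n → Carrier) →
            Σᴿ (λ i → Σᴿ (f i)) ≈ Σᴿ (λ j → Σᴿ (λ i → f i j))
  Σᴿ-comm f = begin
    Σᴿ (λ i → Σᴿ (f i))               ≈⟨ Σᴿ-cong (λ i → Σᴿ≈sum (f i)) ⟩
    Σᴿ (λ i → sum (f i))              ≈⟨ Σᴿ≈sum (λ i → sum (f i)) ⟩
    sum (λ i → sum (f i))             ≈⟨ ∑-comm f ⟩
    sum (λ j → sum (λ i → f i j))     ≈⟨ Σᴿ≈sum (λ j → sum (λ i → f i j)) ⟨
    Σᴿ (λ j → sum (λ i → f i j))      ≈⟨ Σᴿ-cong (λ j → Σᴿ≈sum (λ i → f i j)) ⟨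
    Σᴿ (λ j → Σᴿ (λ i → f i j))       ∎

  idM-suc : ∀ {n} (i j : Fin n) → idM (suc i) (suc j) ≈ idM i j
  idM-suc i j with i ≟ j
  ... | yes _ = refl
  ... | no _  = refl

  Σᴿ-*-idM : ∀ {n} (f : Fin n → Carrier) j → Σᴿ (λ k → f k * idM k j) ≈ f j
  Σᴿ-*-idM {suc n} f zero = begin
    f zero * 1# + Σᴿ (λ k → f (suc k) * 0#)  ≈⟨ +-cong (*-identityʳ _) (Σᴿ-cong (zeroʳ ∘ f ∘ suc)) ⟩
    f zero + Σᴿ {n} (λ _ → 0#)               ≈⟨ +-congˡ (Σᴿ-zero n) ⟩
    f zero + 0#                              ≈⟨ +-identityʳ _ ⟩
    f zero                                   ∎
  Σᴿ-*-idM {suc n} f (suc j) = begin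
    f zero * 0# + Σᴿ (λ k → f (suc k) * idM (suc k) (suc j))
      ≈⟨ +-cong (zeroʳ _) (Σᴿ-cong (λ k → *-congˡ (idM-suc k j))) ⟩
    0# + Σᴿ (λ k → f (suc k) * idM k j)  ≈⟨ +-identityˡ _ ⟩
    Σᴿ (λ k → f (suc k) * idM k j)       ≈⟨ Σᴿ-*-idM (f ∘ suc) j ⟩
    f (suc j)                            ∎

module MatrixAction {c ℓ} (R : CommutativeRing c ℓ) where
  open CommutativeRing R hiding (zero)
  open Over R
  open Summation R
  open import Relation.Binary.Reasoning.Setoid setoid

  ·ᵥ-congˡ : ∀ {n} (A : Mat n) {u v : Vec n} → u ≈ᵥ v → (A ·ᵥ u) ≈ᵥ (A ·ᵥ v)
  ·ᵥ-congˡ A u≈v i = Σᴿ-cong (λ j → *-congˡ (u≈v j))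

  ·ᵥ-zeroʳ : ∀ {n} (A : Mat n) → (A ·ᵥ zeroV) ≈ᵥ zeroV
  ·ᵥ-zeroʳ {n} A i = trans (Σᴿ-cong (λ j → zeroʳ (A i j))) (Σᴿ-zero n)

  ·ᵥ-linear : ∀ {n} (A : Mat n) a (u v : Vec n) →
              (A ·ᵥ addV (scal a u) v) ≈ᵥ addV (scal a (A ·ᵥ u)) (A ·ᵥ v)
  ·ᵥ-linear {n} A a u v i = begin
    Σᴿ (λ j → A i j * (a * u j + v j))
      ≈⟨ Σᴿ-cong {n} (λ j → distribˡ (A i j) _ _) ⟩
    Σᴿ (λ j → A i j * (a * u j) + A i j * v j)
      ≈⟨ Σᴿ-distrib-+ {n} _ _ ⟩
    Σᴿ (λ j → A i j * (a * u j)) + Σᴿ (λ j → A i j * v j)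
      ≈⟨ +-congʳ (Σᴿ-cong {n} (λ j → x∙yz≈y∙xz (A i j) a (u j))) ⟩
    Σᴿ (λ j → a * (A i j * u j)) + Σᴿ (λ j → A i j * v j)
      ≈⟨ +-congʳ (*-distribˡ-Σᴿ {n} a _) ⟨
    a * Σᴿ (λ j → A i j * u j) + Σᴿ (λ j → A i j * v j) ∎
    where open import Algebra.Properties.CommutativeSemigroup *-commutativeSemigroup
            using (x∙yz≈y∙xz)

  ·ᵥ-assoc : ∀ {n} (A B : Mat n) (v : Vec n) → (A ·ᵥ (B ·ᵥ v)) ≈ᵥ ((A ·ₘ B) ·ᵥ v)
  ·ᵥ-assoc {n} A B v i = begin
    Σᴿ (λ j → A i j * Σᴿ (λ k → B j k * v k))
      ≈⟨ Σᴿ-cong {n} (λ j → *-distribˡ-Σᴿ {n} (A i j) _) ⟩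
    Σᴿ (λ j → Σᴿ (λ k → A i j * (B j k * v k)))
      ≈⟨ Σᴿ-cong {n} (λ j → Σᴿ-cong {n} (λ k → *-assoc _ _ _)) ⟨
    Σᴿ (λ j → Σᴿ (λ k → A i j * B j k * v k))
      ≈⟨ Σᴿ-comm {n} {n} _ ⟩
    Σᴿ (λ k → Σᴿ (λ j → A i j * B j k * v k))
      ≈⟨ Σᴿ-cong {n} (λ k → *-distribʳ-Σᴿ {n} (v k) _) ⟨
    Σᴿ (λ k → Σᴿ (λ j → A i j * B j k) * v k) ∎

  ·ᵥ-idMColumn : ∀ {n} (A : Mat n) i j → (A ·ᵥ (λ k → idM k j)) i ≈ A i j
  ·ᵥ-idMColumn A i = Σᴿ-*-idM (A i)

  ·ᵥ-comm : ∀ {n} {A B : Mat n} → (A ·ₘ B) ≈ₘ (B ·ₘ A) →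
            ∀ v → (A ·ᵥ (B ·ᵥ v)) ≈ᵥ (B ·ᵥ (A ·ᵥ v))
  ·ᵥ-comm {A = A} {B} AB≈BA v i = begin
    (A ·ᵥ (B ·ᵥ v)) i    ≈⟨ ·ᵥ-assoc A B v i ⟩
    ((A ·ₘ B) ·ᵥ v) i    ≈⟨ Σᴿ-cong (λ k → *-congʳ (AB≈BA i k)) ⟩
    ((B ·ₘ A) ·ᵥ v) i    ≈⟨ ·ᵥ-assoc B A v i ⟨
    (B ·ᵥ (A ·ᵥ v)) i    ∎

  fixesAll⇒≈idM : ∀ {n} (A : Mat n) → (∀ v → (A ·ᵥ v) ≈ᵥ v) → A ≈ₘ idM
  fixesAll⇒≈idM A fixes i j = trans (sym (·ᵥ-idMColumn A i j)) (fixes (λ k → idM k j) i)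

  fixes-polyAct : ∀ {n} {g τ : Mat n} → (g ·ₘ τ) ≈ₘ (τ ·ₘ g) →
                  ∀ {v} → (g ·ᵥ v) ≈ᵥ v → ∀ p → (g ·ᵥ polyAct τ p v) ≈ᵥ polyAct τ p v
  fixes-polyAct {g = g} gτ≈τg gv≈v [] = ·ᵥ-zeroʳ g
  fixes-polyAct {g = g} {τ} gτ≈τg {v} gv≈v (a ∷ p) i = begin
    (g ·ᵥ addV (scal a v) (τ ·ᵥ w)) i    ≈⟨ ·ᵥ-linear g a v _ i ⟩
    a * (g ·ᵥ v) i + (g ·ᵥ (τ ·ᵥ w)) i   ≈⟨ +-cong (*-congˡ (gv≈v i)) (·ᵥ-comm gτ≈τg w i) ⟩
    a * v i + (τ ·ᵥ (g ·ᵥ w)) i          ≈⟨ +-congˡ (·ᵥ-congˡ τ (fixes-polyAct gτ≈τg gv≈v p) i) ⟩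
    a * v i + (τ ·ᵥ w) i                 ∎
    where w = polyAct τ p v

lemma4p6 : ∀ {c ℓ : Level} (R : CommutativeRing c ℓ) (n : ℕ) (e e* : Fin n → ℤ)
    → pairℤ e* e ≡ Data.Integer.+ 1
    → (τ : Over.Mat R n) → Over.IsStable R e e* τ
    → (g : Over.Mat R n) → Over.InH R e e* g → Over.InGτ R τ g
    → Over._≈ₘ_ R g (Over.idM R)
lemma4p6 R n e e* _ τ (cyclic , _) g (_ , ge≈e , _) (_ , gτ≈τg) =
  fixesAll⇒≈idM g fixesAll
  where
    open CommutativeRing R hiding (zero)
    open Over R
    open MatrixAction R

    fixesAll : ∀ v → (g ·ᵥ v) ≈ᵥ v
    fixesAll v i with cyclic v
    ... | p , pτe≈v = begin
      (g ·ᵥ v) i                      ≈⟨ ·ᵥ-congˡ g pτe≈v i ⟨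
      (g ·ᵥ polyAct τ p (baseV e)) i  ≈⟨ fixes-polyAct gτ≈τg ge≈e p i ⟩
      polyAct τ p (baseV e) i         ≈⟨ pτe≈v i ⟩
      v i                             ∎
      where open import Relation.Binary.Reasoning.Setoid setoid
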